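{- Let $\mathcal{V}$ be a locally finite equational class. Then $\mathrm{type}(\mathsf{C}_{\mathcal{V}}(\mathbf{A}))\in\{1,\omega\}$ for each finitely presented $\mathbf{A}\in\mathcal{V}$ (for which this type is defined, i.e., $\mathsf{C}_{\mathcal{V}}(\mathbf{A})\neq\emptyset$). Hence $\mathcal{V}$ has unitary or finitary exact type.
   Context: $\mathbf{F}_{\mathcal{V}}(\omega)$ is the free algebra of $\mathcal{V}$ on countably many generators. An algebra is exact in $\mathcal{V}$ if it is isomorphic to a finitely generated subalgebra of $\mathbf{F}_{\mathcal{V}}(\omega)$. For finitely presented $\mathbf{A}\in\mathcal{V}$, a coexact unifier is an onto homomorphism $u\colon\mathbf{A}\to\mathbf{E}$ with $\mathbf{E}$ exact; $\mathsf{C}_{\mathcal{V}}(\mathbf{A})$ is the set of these preordered by $u\le v$ iff $f\circ v=u$ for some homomorphism $f$. Types of a preordered set $(P,\le)$: a complete set is $M\subseteq P$ with every $x\in P$ below some $y\in M$; a $\mu$-set is a complete set of pairwise incomparable elements; $\mathrm{type}(P)$ is $0$ if no $\mu$-set, $\infty$ if an infinite $\mu$-set, $\omega$ if a finite $\mu$-set of size $>1$, $1$ if a $\mu$-set of size $1$; ordered $1<\omega<\infty<0$. With $\mathbf{Fm}_{\mathcal{L}}(Y)$ the formula algebra, $h_{\mathcal{V}}$ the canonical map onto the free algebra and $\omega$ a countable set of variables: a substitution $\sigma\colon\mathbf{Fm}_{\mathcal{L}}(\mathrm{Var}(\Sigma))\to\mathbf{Fm}_{\mathcal{L}}(\omega)$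 is a $\mathcal{V}$-unifier of a finite set $\Sigma$ of identities if $\mathcal{V}\models\sigma(\varphi)\approx\sigma(\psi)$ for all $\varphi\approx\psi\in\Sigma$; $\mathsf{E}_{\mathcal{V}}(\Sigma)$ is the set of these preordered by $\sigma_2\sqsubseteq\sigma_1$ iff $\ker(h_{\mathcal{V}}\circ\sigma_1)\subseteq\ker(h_{\mathcal{V}}\circ\sigma_2)$; the exact type of $\mathcal{V}$ is the maximum of $\mathrm{type}(\mathsf{E}_{\mathcal{V}}(\Sigma))$ over finite $\mathcal{V}$-unifiable $\Sigma$. -}

module Defs where

open import Level using (Level; _⊔_) renaming (suc to lsuc)
open import Data.Nat using (ℕ; zero; suc; _≡ᵇ_; _>_)
open import Data.Fin using (Fin)
open import Data.Bool using (Bool; true; false; _∨_; T)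
open import Data.List using (List; []; _∷_; length; lookup)
open import Data.List.Membership.Propositional using (_∈_)
open import Data.Product using (Σ; ∃; ∃-syntax; _×_; _,_; proj₁; proj₂)
open import Data.Sum using (_⊎_)
open import Data.Unit using (tt)
open import Relation.Binary.PropositionalEquality using (_≡_)
open import Relation.Binary.Structures using (IsEquivalence)
open import Relation.Nullary using (¬_)

module _ {a b : Level} {P : Set a} (_≤_ : P → P → Set b) where

  Complete : List P → Set (a ⊔ b)
  Complete M = ∀ x → ∃[ k ] (x ≤ lookup M k)

  Antichain : List P → Set b
  Antichain M = ∀ i j → ¬ (i ≡ j) → ¬ (lookup M i ≤ lookup M j)

  FiniteMuSet : List P → Set (a ⊔ b)
  FiniteMuSet M = Complete M × Antichain M

  Type1 : Set (a ⊔ b)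
  Type1 = ∃[ y ] FiniteMuSet (y ∷ [])

  Typeω : Set (a ⊔ b)
  Typeω = ∃[ M ] (length M > 1 × FiniteMuSet M)

  UnitaryOrFinitary : Set (a ⊔ b)
  UnitaryOrFinitary = Type1 ⊎ Typeω

record Signature : Set₁ where
  field
    Op    : Set
    arity : Op → ℕ

module _ (S : Signature) where
  open Signature S

  data Term (X : Set) : Set where
    var  : X → Term X
    node : (f : Op) → (Fin (arity f) → Term X) → Term X

  _[_] : {X Y : Set} → Term X → (X → Term Y) → Term Y
  var x [ σ ] = σ x
  node f ts [ σ ] = node f (λ i → ts i [ σ ])

  record Algebra : Set₁ where
    field
      Carrier       : Set
      _≈_           : Carrier → Carrier → Set
      isEquivalence : IsEquivalence _≈_
      ⟦_⟧           : (f : Op) → (Fin (arity f) → Carrier) → Carrier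
      ⟦⟧-cong       : ∀ f {as bs} → (∀ i → as i ≈ bs i) → ⟦ f ⟧ as ≈ ⟦ f ⟧ bs

  open Algebra

  eval : {X : Set} (A : Algebra) → (X → Carrier A) → Term X → Carrier A
  eval A ρ (var x) = ρ x
  eval A ρ (node f ts) = ⟦ A ⟧ f (λ i → eval A ρ (ts i))

  record Hom (A B : Algebra) : Set where
    field
      fun  : Carrier A → Carrier B
      cong : ∀ {x y} → _≈_ A x y → _≈_ B (fun x) (fun y)
      hom  : ∀ f (as : Fin (arity f) → Carrier A) →
             _≈_ B (fun (⟦ A ⟧ f as)) (⟦ B ⟧ f (λ i → fun (as i)))

  open Hom

  Onto : {A B : Algebra} → Hom A B → Set
  Onto {A} {B} h = ∀ b → ∃[ a ] (_≈_ B (fun h a) b)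

  record _≅_ (A B : Algebra) : Set where
    field
      to    : Hom A B
      from  : Hom B A
      from∘to : ∀ a → _≈_ A (fun from (fun to a)) a
      to∘from : ∀ b → _≈_ B (fun to (fun from b)) b

  FinitelyGenerated : Algebra → Set
  FinitelyGenerated A =
    ∃[ n ] Σ (Fin n → Carrier A) λ g → ∀ a → ∃[ t ] (_≈_ A (eval A g t) a)

  Finite : Algebra → Set
  Finite A = ∃[ m ] Σ (Fin m → Carrier A) λ e → ∀ a → ∃[ i ] (_≈_ A (e i) a)

  -- Equational classes: V = Mod(Th) for a set of identities Th

  record Theory : Set₁ where
    field
      Ax  : Set
      lhs : Ax → Term ℕ
      rhs : Ax → Term ℕ

  open Theory

  _∈V_ : Algebra → Theory → Set
  A ∈V Th = ∀ (e : Ax Th) (ρ : ℕ → Carrier A) → _≈_ A (eval A ρ (lhs Th e)) (eval A ρ (rhs Th e))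

  -- derivability in equational logic of V, with extra ground relations R
  -- (the congruence on Fm(X) generated by R and the fully invariant
  --  congruence of V)
  data Der (Th : Theory) {X : Set} (R : List (Term X × Term X)) : Term X → Term X → Set where
    ax    : ∀ e (σ : ℕ → Term X) → Der Th R (lhs Th e [ σ ]) (rhs Th e [ σ ])
    hyp   : ∀ {s t} → (s , t) ∈ R → Der Th R s t
    drefl  : ∀ {s} → Der Th R s s
    dsym   : ∀ {s t} → Der Th R s t → Der Th R t s
    dtrans : ∀ {s t u} → Der Th R s t → Der Th R t u → Der Th R s u
    dcong  : ∀ f {ss ts} → (∀ i → Der Th R (ss i) (ts i)) → Der Th R (node f ss) (node f ts)

  _⊢_≈_ : Theory → {X : Set} → Term X → Term X → Set
  Th ⊢ s ≈ t = Der Th [] s t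

  Presented : (Th : Theory) (X : Set) → List (Term X × Term X) → Algebra
  Presented Th X R = record
    { Carrier = Term X
    ; _≈_ = Der Th R
    ; isEquivalence = record { refl = drefl ; sym = dsym ; trans = dtrans }
    ; ⟦_⟧ = node
    ; ⟦⟧-cong = dcong
    }

  Free : Theory → Set → Algebra
  Free Th X = Presented Th X []

  Fω : Theory → Algebra
  Fω Th = Free Th ℕ

  FinitelyPresented : Theory → Algebra → Set
  FinitelyPresented Th A =
    ∃[ n ] Σ (List (Term (Fin n) × Term (Fin n))) λ R → A ≅ Presented Th (Fin n) R

  LocallyFinite : Theory → Set₁
  LocallyFinite Th = ∀ (A : Algebra) → A ∈V Th → FinitelyGenerated A → Finite A

  Sg : (Th : Theory) {n : ℕ} → (Fin n → Term ℕ) → Algebra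
  Sg Th {n} g = record
    { Carrier = Σ (Term ℕ) λ t → ∃[ s ] (Th ⊢ t ≈ (s [ g ]))
    ; _≈_ = λ x y → Th ⊢ proj₁ x ≈ proj₁ y
    ; isEquivalence = record { refl = drefl ; sym = dsym ; trans = dtrans }
    ; ⟦_⟧ = λ f as → node f (λ i → proj₁ (as i))
                   , node f (λ i → proj₁ (proj₂ (as i)))
                     , dcong f (λ i → proj₂ (proj₂ (as i)))
    ; ⟦⟧-cong = λ f p → dcong f p
    }

  Exact : Theory → Algebra → Set
  Exact Th E = ∃[ n ] Σ (Fin n → Term ℕ) λ g → E ≅ Sg Th g

  record Coexact (Th : Theory) (A : Algebra) : Set₁ where
    field
      E     : Algebra
      exact : Exact Th E
      u     : Hom A E
      onto  : Onto u

  _≤C_ : {Th : Theory} {A : Algebra} → Coexact Th A → Coexact Th A → Set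
  _≤C_ {A = A} x y =
    Σ (Hom (Coexact.E y) (Coexact.E x)) λ f →
      ∀ a → _≈_ (Coexact.E x) (fun f (fun (Coexact.u y) a)) (fun (Coexact.u x) a)

  anyFin : {n : ℕ} → (Fin n → Bool) → Bool
  anyFin {zero} p = false
  anyFin {suc n} p = p Fin.zero ∨ anyFin (λ i → p (Fin.suc i))

  occT : ℕ → Term ℕ → Bool
  occT x (var y) = x ≡ᵇ y
  occT x (node f ts) = anyFin (λ i → occT x (ts i))

  occΣ : ℕ → List (Term ℕ × Term ℕ) → Bool
  occΣ x [] = false
  occΣ x ((φ , ψ) ∷ Es) = occT x φ ∨ occT x ψ ∨ occΣ x Es

  VarΣ : List (Term ℕ × Term ℕ) → Set
  VarΣ Es = Σ ℕ λ x → T (occΣ x Es)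

  private
    extB : (b : Bool) → (T b → Term ℕ) → Term ℕ → Term ℕ
    extB true k d = k tt
    extB false k d = d

  -- view a substitution on Var(Σ) as acting on the variables of Σ
  -- (the default value is never used on variables occurring in Σ)
  ext : (Es : List (Term ℕ × Term ℕ)) → (VarΣ Es → Term ℕ) → ℕ → Term ℕ
  ext Es σ x = extB (occΣ x Es) (λ p → σ (x , p)) (var x)

  record Unifier (Th : Theory) (Es : List (Term ℕ × Term ℕ)) : Set where
    field
      σ     : VarΣ Es → Term ℕ
      unify : ∀ k → Th ⊢ (proj₁ (lookup Es k) [ ext Es σ ]) ≈ (proj₂ (lookup Es k) [ ext Es σ ])

  _⊑_ : {Th : Theory} {Es : List (Term ℕ × Term ℕ)} → Unifier Th Es → Unifier Th Es → Set
  _⊑_ {Th} {Es} σ₂ σ₁ = ∀ (s t : Term (VarΣ Es)) →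
    Th ⊢ (s [ Unifier.σ σ₁ ]) ≈ (t [ Unifier.σ σ₁ ]) →
    Th ⊢ (s [ Unifier.σ σ₂ ]) ≈ (t [ Unifier.σ σ₂ ])

-- Both preorders are kernel orders: x ≤ y as soon as ker y ⊆ ker x, for maps out of a single
-- algebra D that local finiteness makes finite.  On a
-- finite D a kernel is fixed by the finitely many pairs of elements it identifies, so classically
-- only finitely many kernels occur.  One representative per occurring kernel is a finite complete
-- set, and its maximal elements form a finite μ-set, which is nonempty as the preorder is.
module Submission where

open import Defs
open import Level using (0ℓ) renaming (suc to lsuc)
open import Axiom.ExcludedMiddle using (ExcludedMiddle)
open import Data.Bool using (Bool; T)
open import Data.Bool.Properties using (T-∨; T-irrelevant)
open import Data.Fin using (Fin; zero; suc; toℕ; fromℕ<)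
open import Data.Fin.Properties using (¬Fin0; toℕ-fromℕ<)
open import Data.List using (List; []; _∷_; [_]; _++_; lookup; filter; allFin; cartesianProduct)
open import Data.List.Membership.Propositional using (_∈_; find; lose)
open import Data.List.Membership.Propositional.Properties
  using (∈-filter⁺; ∈-lookup; ∈-allFin; ∈-cartesianProduct⁺)
open import Data.List.Relation.Unary.All as All using (All; []; _∷_)
open import Data.List.Relation.Unary.All.Properties using (all-filter; filter⁺; ¬Any⇒All¬)
open import Data.List.Relation.Unary.AllPairs using (AllPairs; []; _∷_)
import Data.List.Relation.Unary.AllPairs.Properties as AllPairs
open import Data.List.Relation.Unary.Any as Any using (Any; here; there; any?; index)
open import Data.List.Relation.Unary.Any.Properties using (++⁺ˡ; ++⁺ʳ; lookup-index)
open import Data.Nat using (ℕ; zero; suc; _<_; _⊔_; s≤s; z≤n)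
open import Data.Nat.Properties using (≡ᵇ⇒≡; n<1+n; m<n⇒m<n⊔o; m<n⇒m<o⊔n)
open import Data.Product using (Σ; ∃-syntax; _×_; _,_; proj₁; proj₂; swap)
open import Data.Empty using (⊥-elim)
open import Data.Sum using (_⊎_; inj₁; inj₂; [_,_]′)
open import Data.Unit using (⊤; tt)
open import Function using (_∘_; _on_; Func; Equivalence)
open import Relation.Binary using (Rel; Setoid; Symmetric; Transitive; Decidable; _⇒_)
open import Relation.Binary.PropositionalEquality using (_≡_; _≢_; refl; cong)
import Relation.Binary.PropositionalEquality as ≡
import Relation.Binary.Reasoning.Setoid
open import Relation.Nullary using (¬_; Dec; yes; no; ¬?; contradiction)
open import Relation.Nullary.Decidable using (T?)

module _ {a r} {A : Set a} {R : Rel A r} (R-sym : Symmetric R) where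

  AllPairs-lookup : ∀ {xs} → AllPairs R xs → ∀ i j → i ≢ j → R (lookup xs i) (lookup xs j)
  AllPairs-lookup (_ ∷ _)    zero    zero    i≢j = contradiction refl i≢j
  AllPairs-lookup (Rx ∷ _)   zero    (suc j) _   = All.lookup Rx (∈-lookup j)
  AllPairs-lookup (Rx ∷ _)   (suc i) zero    _   = R-sym (All.lookup Rx (∈-lookup i))
  AllPairs-lookup (_ ∷ Rxs)  (suc i) (suc j) i≢j = AllPairs-lookup Rxs i j (i≢j ∘ cong suc)

module _ {a} {P : Set a} (_≤_ : Rel P 0ℓ) where

  FiniteMuSet⇒UnitaryOrFinitary : P → ∀ M → FiniteMuSet _≤_ M → UnitaryOrFinitary _≤_
  FiniteMuSet⇒UnitaryOrFinitary p []          (complete , _) = ⊥-elim (¬Fin0 (proj₁ (complete p)))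
  FiniteMuSet⇒UnitaryOrFinitary _ (y ∷ [])    μ = inj₁ (y , μ)
  FiniteMuSet⇒UnitaryOrFinitary _ (y ∷ z ∷ M) μ = inj₂ (y ∷ z ∷ M , s≤s (s≤s z≤n) , μ)

module MaximalElements {a} {P : Set a} {_≤_ : Rel P 0ℓ}
                       (≤-trans : Transitive _≤_) (_≤?_ : Decidable _≤_) where

  Incomparable : Rel P 0ℓ
  Incomparable x y = ¬ x ≤ y × ¬ y ≤ x

  ≰? : ∀ x m → Dec (¬ m ≤ x)
  ≰? x m = ¬? (m ≤? x)

  notBelow : P → List P → List P
  notBelow x = filter (≰? x)

  notBelow-dominates : ∀ x M {y} → Any (y ≤_) M → Any (y ≤_) (notBelow x M) ⊎ y ≤ x
  notBelow-dominates x M y≤M with find y≤M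
  ... | m , m∈M , y≤m with m ≤? x
  ...   | yes m≤x = inj₂ (≤-trans y≤m m≤x)
  ...   | no  m≰x = inj₁ (lose (∈-filter⁺ (≰? x) m∈M m≰x) y≤m)

  maximals : List P → List P
  maximals [] = []
  maximals (x ∷ M) with any? (x ≤?_) (maximals M)
  ... | yes _ = maximals M
  ... | no  _ = x ∷ notBelow x (maximals M)

  maximals-pairwise : ∀ M → AllPairs Incomparable (maximals M)
  maximals-pairwise [] = []
  maximals-pairwise (x ∷ M) with any? (x ≤?_) (maximals M)
  ... | yes _   = maximals-pairwise M
  ... | no  x≰M = All.zip (filter⁺ (≰? x) (¬Any⇒All¬ _ x≰M) , all-filter (≰? x) (maximals M))
                ∷ AllPairs.filter⁺ (≰? x) (maximals-pairwise M)

  maximals-dominates : ∀ M {y} → Any (y ≤_) M → Any (y ≤_) (maximals M)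
  maximals-dominates (x ∷ M) y≤M with any? (x ≤?_) (maximals M) | y≤M
  ... | yes x≤N | here y≤x  = Any.map (≤-trans y≤x) x≤N
  ... | yes _   | there y≤M = maximals-dominates M y≤M
  ... | no  _   | here y≤x  = here y≤x
  ... | no  _   | there y≤M =
    [ there , here ]′ (notBelow-dominates x (maximals M) (maximals-dominates M y≤M))

  finitelyCovered⇒UnitaryOrFinitary : P → (L : List P) → (∀ y → Any (y ≤_) L) →
                                      UnitaryOrFinitary _≤_
  finitelyCovered⇒UnitaryOrFinitary p L cover =
    FiniteMuSet⇒UnitaryOrFinitary _≤_ p (maximals L) (complete , antichain)
    where
      complete : Complete _≤_ (maximals L)
      complete y = let y≤M = maximals-dominates L (cover y) in index y≤M , lookup-index y≤M

      antichain : Antichain _≤_ (maximals L)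
      antichain i j i≢j = proj₁ (AllPairs-lookup swap (maximals-pairwise L) i j i≢j)

open MaximalElements using (finitelyCovered⇒UnitaryOrFinitary)

module _ {a} {P : Set a} {I : Set} (κ : P → I → Set) (κ? : ∀ x i → Dec (κ x i))
         (em : ExcludedMiddle a) where

  _⇛[_]_ : P → List I → P → Set
  l ⇛[ is ] x = All (λ i → κ l i → κ x i) is

  -- Split C by the first test; once no tests are left, excluded middle picks one witness of C.
  representatives : (is : List I) (C : P → Set) →
                    Σ (List P) λ L → ∀ x → C x → Any (λ l → C l × l ⇛[ is ] x) L
  representatives [] C with em {∃[ x ] C x}
  ... | yes (r , Cr) = [ r ] , λ _ _ → here (Cr , [])
  ... | no  ∄C       = [] , λ x Cx → contradiction (x , Cx) ∄C
  representatives (i ∷ is) C = L₊ ++ L₋ , cover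
    where
      C₊ C₋ : P → Set
      C₊ x = C x × κ x i
      C₋ x = C x × ¬ κ x i

      L₊ L₋ : List P
      L₊ = proj₁ (representatives is C₊)
      L₋ = proj₁ (representatives is C₋)

      cover : ∀ x → C x → Any (λ l → C l × l ⇛[ i ∷ is ] x) (L₊ ++ L₋)
      cover x Cx with κ? x i
      ... | yes κxi = ++⁺ˡ (Any.map (λ ((Cl , _) , l⇛x) → Cl , (λ _ → κxi) ∷ l⇛x)
                                    (proj₂ (representatives is C₊) x (Cx , κxi)))
      ... | no ¬κxi = ++⁺ʳ L₊ (Any.map (λ ((Cl , ¬κli) , l⇛x) → Cl , (⊥-elim ∘ ¬κli) ∷ l⇛x)
                                       (proj₂ (representatives is C₋) x (Cx , ¬κxi)))

  finitelyTested⇒UnitaryOrFinitary :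
    {_≤_ : Rel P 0ℓ} → Transitive _≤_ → Decidable _≤_ →
    (is : List I) → (∀ i → i ∈ is) → (∀ {x y} → (∀ i → κ y i → κ x i) → x ≤ y) →
    P → UnitaryOrFinitary _≤_
  finitelyTested⇒UnitaryOrFinitary {_≤_} ≤-trans _≤?_ is all∈is tests⇒≤ p =
    finitelyCovered⇒UnitaryOrFinitary ≤-trans _≤?_ p L cover
    where
      L : List P
      L = proj₁ (representatives is (λ _ → ⊤))

      cover : ∀ x → Any (x ≤_) L
      cover x = Any.map (λ (_ , l⇛x) → tests⇒≤ (λ i → All.lookup l⇛x (all∈is i)))
                        (proj₂ (representatives is (λ _ → ⊤)) x tt)

module _ {D : Setoid 0ℓ 0ℓ} where
  open Setoid D using () renaming (Carrier to D₀; _≈_ to _≈D_; sym to symD)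

  Ker : {B : Setoid 0ℓ 0ℓ} → Func D B → Rel D₀ 0ℓ
  Ker {B} f = Setoid._≈_ B on Func.to f

  Ker-resp : {B : Setoid 0ℓ 0ℓ} (f : Func D B) {d₁ d₂ d₁′ d₂′ : D₀} →
             d₁ ≈D d₂ → d₁′ ≈D d₂′ → Ker f d₁ d₁′ → Ker f d₂ d₂′
  Ker-resp {B} f d₁≈d₂ d₁′≈d₂′ k = trans (sym (Func.cong f d₁≈d₂)) (trans k (Func.cong f d₁′≈d₂′))
    where open Setoid B

  Ker⇒-fromEnumeration : {B C : Setoid 0ℓ 0ℓ} {m : ℕ} (e : Fin m → D₀) → (∀ d → ∃[ i ] e i ≈D d) →
                         (f : Func D B) (g : Func D C) → (Ker f on e) ⇒ (Ker g on e) → Ker f ⇒ Ker g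
  Ker⇒-fromEnumeration e e-onto f g restricted {d} {d′} fd≈fd′
    with i , eᵢ≈d ← e-onto d | j , eⱼ≈d′ ← e-onto d′
    = Ker-resp g eᵢ≈d eⱼ≈d′ (restricted (Ker-resp f (symD eᵢ≈d) (symD eⱼ≈d′) fd≈fd′))

finiteKernels⇒UnitaryOrFinitary :
  ∀ {a} → ExcludedMiddle a → ExcludedMiddle 0ℓ →
  {P : Set a} (_≤_ : Rel P 0ℓ) → Transitive _≤_ →
  {D : Setoid 0ℓ 0ℓ} {m : ℕ} (e : Fin m → Setoid.Carrier D) → (∀ d → ∃[ i ] Setoid._≈_ D (e i) d) →
  {T : P → Setoid 0ℓ 0ℓ} (φ : ∀ x → Func D (T x)) → (∀ x y → Ker (φ y) ⇒ Ker (φ x) → x ≤ y) →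
  P → UnitaryOrFinitary _≤_
finiteKernels⇒UnitaryOrFinitary em em₀ {P} _≤_ ≤-trans {m = m} e e-onto φ Ker⇒≤ =
  finitelyTested⇒UnitaryOrFinitary κ (λ _ _ → em₀) em ≤-trans (λ _ _ → em₀) pairs ∈-pairs
    (λ {x} {y} κy⇒κx →
       Ker⇒≤ x y (Ker⇒-fromEnumeration e e-onto (φ y) (φ x) (λ {i} {j} → κy⇒κx (i , j))))
  where
    κ : P → Fin m × Fin m → Set
    κ x (i , j) = Ker (φ x) (e i) (e j)

    pairs : List (Fin m × Fin m)
    pairs = cartesianProduct (allFin m) (allFin m)

    ∈-pairs : ∀ ij → ij ∈ pairs
    ∈-pairs (i , j) = ∈-cartesianProduct⁺ (∈-allFin i) (∈-allFin j)

⨆ : ∀ {n} → (Fin n → ℕ) → ℕ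
⨆ {zero}  h = 0
⨆ {suc n} h = h zero ⊔ ⨆ (h ∘ suc)

<-⨆ : ∀ {n x} (h : Fin n → ℕ) i → x < h i → x < ⨆ h
<-⨆ h zero    x<h₀ = m<n⇒m<n⊔o _ x<h₀
<-⨆ h (suc i) x<hᵢ = m<n⇒m<o⊔n (h zero) (<-⨆ (h ∘ suc) i x<hᵢ)

module _ {S : Signature} where
  open Signature S using (arity)
  open Algebra using (Carrier; ⟦_⟧; ⟦⟧-cong)
  open Hom using (fun; hom)

  setoid : Algebra S → Setoid 0ℓ 0ℓ
  setoid A = record { Algebra A }

  toFunc : {A B : Algebra S} → Hom S A B → Func (setoid A) (setoid B)
  toFunc h = record { to = fun h ; cong = Hom.cong h }

  _∘ₕ_ : {A B C : Algebra S} → Hom S B C → Hom S A B → Hom S A C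
  _∘ₕ_ {C = C} g f = record
    { fun  = fun g ∘ fun f
    ; cong = Hom.cong g ∘ Hom.cong f
    ; hom  = λ o as → Setoid.trans (setoid C) (Hom.cong g (hom f o as)) (hom g o _)
    }

  eval-hom : {X : Set} {A B : Algebra S} (h : Hom S A B) (ρ : X → Carrier A) (t : Term S X) →
             Setoid._≈_ (setoid B) (eval S B (fun h ∘ ρ) t) (fun h (eval S A ρ t))
  eval-hom {B = B} h ρ (var x)     = Setoid.refl (setoid B)
  eval-hom {B = B} h ρ (node f ts) = trans (⟦⟧-cong B f (λ i → eval-hom h ρ (ts i))) (sym (hom h f _))
    where open Setoid (setoid B)

  Onto-finitelyGenerated : {A B : Algebra S} (h : Hom S A B) → Onto S h →
                           FinitelyGenerated S A → FinitelyGenerated S B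
  Onto-finitelyGenerated {B = B} h h-onto (n , g , g-generates) = n , fun h ∘ g , generates
    where
      open Setoid (setoid B)
      generates : ∀ b → ∃[ t ] eval S B (fun h ∘ g) t ≈ b
      generates b = let a , ha≈b = h-onto b; t , gt≈a = g-generates a in
        t , trans (eval-hom h g t) (trans (Hom.cong h gt≈a) ha≈b)

  factorThroughOnto : {A B C : Algebra S} (v : Hom S A C) → Onto S v → (u : Hom S A B) →
                      Ker (toFunc v) ⇒ Ker (toFunc u) →
                      Σ (Hom S C B) λ f → ∀ a → Setoid._≈_ (setoid B) (fun f (fun v a)) (fun u a)
  factorThroughOnto {A} {B} {C} v v-onto u v⇒u = f , λ a → v⇒u (v∘section (fun v a))
    where
      module C = Setoid (setoid C)
      module B = Setoid (setoid B)

      section : Carrier C → Carrier A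
      section c = proj₁ (v-onto c)

      v∘section : ∀ c → fun v (section c) C.≈ c
      v∘section c = proj₂ (v-onto c)

      f-hom : ∀ o (cs : Fin (arity o) → Carrier C) →
              fun u (section (⟦ C ⟧ o cs)) B.≈ ⟦ B ⟧ o (fun u ∘ section ∘ cs)
      f-hom o cs = B.trans (v⇒u v-agrees) (hom u o (section ∘ cs))
        where
          open Relation.Binary.Reasoning.Setoid (setoid C)
          v-agrees : fun v (section (⟦ C ⟧ o cs)) C.≈ fun v (⟦ A ⟧ o (section ∘ cs))
          v-agrees = begin
            fun v (section (⟦ C ⟧ o cs))     ≈⟨ v∘section _ ⟩
            ⟦ C ⟧ o cs                       ≈⟨ ⟦⟧-cong C o (λ i → C.sym (v∘section (cs i))) ⟩
            ⟦ C ⟧ o (fun v ∘ section ∘ cs)   ≈⟨ C.sym (hom v o _) ⟩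
            fun v (⟦ A ⟧ o (section ∘ cs))   ∎

      f : Hom S C B
      f = record
        { fun  = fun u ∘ section
        ; cong = λ c≈c′ → v⇒u (C.trans (v∘section _) (C.trans c≈c′ (C.sym (v∘section _))))
        ; hom  = f-hom
        }

  infixl 8 _⟪_⟫
  _⟪_⟫ : {X Y : Set} → Term S X → (X → Term S Y) → Term S Y
  t ⟪ σ ⟫ = _[_] S t σ

  module Equational (Th : Theory S) where

    infix 4 _≈ₜ_
    _≈ₜ_ : {X : Set} → Term S X → Term S X → Set
    _≈ₜ_ = _⊢_≈_ S Th

    eval-var : {X : Set} (R : List (Term S X × Term S X)) (t : Term S X) →
               Der S Th R (eval S (Presented S Th X R) var t) t
    eval-var R (var x)     = drefl
    eval-var R (node f ts) = dcong f (λ i → eval-var R (ts i))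

    eval-subst : {X Y : Set} (R : List (Term S Y × Term S Y)) (ρ : X → Term S Y) (t : Term S X) →
                 Der S Th R (eval S (Presented S Th Y R) ρ t) (t ⟪ ρ ⟫)
    eval-subst R ρ (var x)     = drefl
    eval-subst R ρ (node f ts) = dcong f (λ i → eval-subst R ρ (ts i))

    Presented-finitelyGenerated : {n : ℕ} (R : List (Term S (Fin n) × Term S (Fin n))) →
                                  FinitelyGenerated S (Presented S Th (Fin n) R)
    Presented-finitelyGenerated {n} R = n , var , λ t → t , eval-var R t

    finitelyPresented⇒finitelyGenerated : (A : Algebra S) → FinitelyPresented S Th A →
                                          FinitelyGenerated S A
    finitelyPresented⇒finitelyGenerated A (n , R , A≅) =
      Onto-finitelyGenerated (from A≅) (λ a → fun (to A≅) a , from∘to A≅ a)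
                             (Presented-finitelyGenerated R)
      where open _≅_

    Presented∈V : {X : Set} (R : List (Term S X × Term S X)) → _∈V_ S (Presented S Th X R) Th
    Presented∈V R e ρ =
      dtrans (eval-subst R ρ (Theory.lhs Th e))
             (dtrans (ax e ρ) (dsym (eval-subst R ρ (Theory.rhs Th e))))

    ⟪⟫-assoc : {X Y Z : Set} (t : Term S X) (σ : X → Term S Y) (ρ : Y → Term S Z) →
               t ⟪ σ ⟫ ⟪ ρ ⟫ ≈ₜ t ⟪ (λ x → σ x ⟪ ρ ⟫) ⟫
    ⟪⟫-assoc (var x)     σ ρ = drefl
    ⟪⟫-assoc (node f ts) σ ρ = dcong f (λ i → ⟪⟫-assoc (ts i) σ ρ)

    ⊢-subst : {X Y : Set} {s t : Term S X} (ρ : X → Term S Y) → s ≈ₜ t → s ⟪ ρ ⟫ ≈ₜ t ⟪ ρ ⟫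
    ⊢-subst ρ (ax e σ)       =
      dtrans (⟪⟫-assoc (Theory.lhs Th e) σ ρ)
             (dtrans (ax e _) (dsym (⟪⟫-assoc (Theory.rhs Th e) σ ρ)))
    ⊢-subst ρ (hyp ())
    ⊢-subst ρ drefl          = drefl
    ⊢-subst ρ (dsym d)       = dsym (⊢-subst ρ d)
    ⊢-subst ρ (dtrans d d′)  = dtrans (⊢-subst ρ d) (⊢-subst ρ d′)
    ⊢-subst ρ (dcong f ds)   = dcong f (λ i → ⊢-subst ρ (ds i))

    substFunc : {X Y : Set} → (X → Term S Y) → Func (setoid (Free S Th X)) (setoid (Free S Th Y))
    substFunc ρ = record { to = _⟪ ρ ⟫ ; cong = ⊢-subst ρ }

  open Equational hiding (_≈ₜ_)

  ≤C-trans : {Th : Theory S} {A : Algebra S} → Transitive (_≤C_ S {Th} {A})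
  ≤C-trans {i = x} (f , f∘uy≈ux) (g , g∘uz≈uy) =
    f ∘ₕ g , λ a → Setoid.trans (setoid (Coexact.E x)) (Hom.cong f (g∘uz≈uy a)) (f∘uy≈ux a)

  coexact-UnitaryOrFinitary : ExcludedMiddle 0ℓ → ExcludedMiddle (lsuc 0ℓ) →
    (Th : Theory S) → LocallyFinite S Th → (A : Algebra S) → _∈V_ S A Th →
    FinitelyPresented S Th A → Coexact S Th A → UnitaryOrFinitary (_≤C_ S {Th} {A})
  coexact-UnitaryOrFinitary em₀ em₁ Th lf A A∈V A-fp =
    let m , e , e-onto = lf A A∈V (finitelyPresented⇒finitelyGenerated Th A A-fp) in
    finiteKernels⇒UnitaryOrFinitary em₁ em₀ (_≤C_ S {Th} {A})
      (λ {x} {y} {z} → ≤C-trans {Th} {A} {x} {y} {z}) e e-onto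
      (λ x → toFunc (Coexact.u x))
      (λ x y → factorThroughOnto (Coexact.u y) (Coexact.onto y) (Coexact.u x))

  anyFin-witness : ∀ {n} (p : Fin n → Bool) → T (anyFin S p) → ∃[ i ] T (p i)
  anyFin-witness {suc n} p any with Equivalence.to T-∨ any
  ... | inj₁ p₀   = zero , p₀
  ... | inj₂ rest = let i , pᵢ = anyFin-witness (p ∘ suc) rest in suc i , pᵢ

  varBound : Term S ℕ → ℕ
  varBound (var y)     = suc y
  varBound (node f ts) = ⨆ (varBound ∘ ts)

  occT⇒<varBound : ∀ x t → T (occT S x t) → x < varBound t
  occT⇒<varBound x (var y) occ rewrite ≡ᵇ⇒≡ x y occ = n<1+n y
  occT⇒<varBound x (node f ts) occ =
    let i , occᵢ = anyFin-witness _ occ in <-⨆ (varBound ∘ ts) i (occT⇒<varBound x (ts i) occᵢ)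

  VarΣ-bounded : ∀ Es → ∃[ B ] ∀ x → T (occΣ S x Es) → x < B
  VarΣ-bounded []             = 0 , λ _ ()
  VarΣ-bounded ((φ , ψ) ∷ Es) = varBound φ ⊔ varBound ψ ⊔ B , bounded
    where
      B : ℕ
      B = proj₁ (VarΣ-bounded Es)

      bounded : ∀ x → T (occΣ S x ((φ , ψ) ∷ Es)) → x < varBound φ ⊔ varBound ψ ⊔ B
      bounded x occ with Equivalence.to T-∨ occ
      ... | inj₁ occφ = m<n⇒m<n⊔o B (m<n⇒m<n⊔o (varBound ψ) (occT⇒<varBound x φ occφ))
      ... | inj₂ occ′ with Equivalence.to T-∨ occ′
      ...   | inj₁ occψ  = m<n⇒m<n⊔o B (m<n⇒m<o⊔n (varBound φ) (occT⇒<varBound x ψ occψ))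
      ...   | inj₂ occEs = m<n⇒m<o⊔n _ (proj₂ (VarΣ-bounded Es) x occEs)

  module FiniteVariables (Th : Theory S) (Es : List (Term S ℕ × Term S ℕ))
                         {B : ℕ} (bounded : ∀ x → T (occΣ S x Es) → x < B) where
    open Equational Th using (_≈ₜ_)

    ι : VarΣ S Es → Fin B
    ι (x , occ) = fromℕ< (bounded x occ)

    -- Indices below B that are not variables of Σ get a junk value; only (σ ↾Fin) ∘ ι matters.
    _↾Fin : (VarΣ S Es → Term S ℕ) → Fin B → Term S ℕ
    (σ ↾Fin) k with T? (occΣ S (toℕ k) Es)
    ... | yes occ = σ (toℕ k , occ)
    ... | no  _   = var (toℕ k)

    ↾Fin-var : (σ : VarΣ S Es → Term S ℕ) (k : Fin B) {x : ℕ} (occ : T (occΣ S x Es)) →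
               toℕ k ≡ x → (σ ↾Fin) k ≡ σ (x , occ)
    ↾Fin-var σ k occ refl with T? (occΣ S (toℕ k) Es)
    ... | yes occ′ = cong (λ o → σ (toℕ k , o)) (T-irrelevant occ′ occ)
    ... | no  ¬occ = contradiction occ ¬occ

    ⟪⟫-viaFin : (σ : VarΣ S Es → Term S ℕ) (s : Term S (VarΣ S Es)) →
                s ⟪ σ ⟫ ≈ₜ s ⟪ var ∘ ι ⟫ ⟪ σ ↾Fin ⟫
    ⟪⟫-viaFin σ (var (x , occ)) =
      Setoid.reflexive (setoid (Fω S Th)) (≡.sym (↾Fin-var σ _ occ (toℕ-fromℕ< _)))
    ⟪⟫-viaFin σ (node f ts)     = dcong f (λ i → ⟪⟫-viaFin σ (ts i))

    Ker⇒⊑ : (σ τ : Unifier S Th Es) →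
            Ker (substFunc Th (Unifier.σ τ ↾Fin)) ⇒ Ker (substFunc Th (Unifier.σ σ ↾Fin)) →
            _⊑_ S σ τ
    Ker⇒⊑ σ τ τ⇒σ s t sτ≈tτ = begin
      s ⟪ Unifier.σ σ ⟫                   ≈⟨ ⟪⟫-viaFin (Unifier.σ σ) s ⟩
      s ⟪ var ∘ ι ⟫ ⟪ Unifier.σ σ ↾Fin ⟫  ≈⟨ τ⇒σ {s ⟪ var ∘ ι ⟫} {t ⟪ var ∘ ι ⟫} (begin
        s ⟪ var ∘ ι ⟫ ⟪ Unifier.σ τ ↾Fin ⟫  ≈⟨ ⟪⟫-viaFin (Unifier.σ τ) s ⟨
        s ⟪ Unifier.σ τ ⟫                   ≈⟨ sτ≈tτ ⟩
        t ⟪ Unifier.σ τ ⟫                   ≈⟨ ⟪⟫-viaFin (Unifier.σ τ) t ⟩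
        t ⟪ var ∘ ι ⟫ ⟪ Unifier.σ τ ↾Fin ⟫  ∎) ⟩
      t ⟪ var ∘ ι ⟫ ⟪ Unifier.σ σ ↾Fin ⟫  ≈⟨ ⟪⟫-viaFin (Unifier.σ σ) t ⟨
      t ⟪ Unifier.σ σ ⟫                   ∎
      where open Relation.Binary.Reasoning.Setoid (setoid (Fω S Th))

  ⊑-trans : {Th : Theory S} {Es : List (Term S ℕ × Term S ℕ)} → Transitive (_⊑_ S {Th} {Es})
  ⊑-trans x⊑y y⊑z s t = x⊑y s t ∘ y⊑z s t

  unifiers-UnitaryOrFinitary : ExcludedMiddle 0ℓ → (Th : Theory S) → LocallyFinite S Th →
    (Es : List (Term S ℕ × Term S ℕ)) → Unifier S Th Es → UnitaryOrFinitary (_⊑_ S {Th} {Es})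
  unifiers-UnitaryOrFinitary em₀ Th lf Es =
    let B , bounded    = VarΣ-bounded Es
        m , e , e-onto =
          lf (Free S Th (Fin B)) (Presented∈V Th []) (Presented-finitelyGenerated Th [])
        open FiniteVariables Th Es bounded
    in finiteKernels⇒UnitaryOrFinitary em₀ em₀ (_⊑_ S {Th} {Es})
         (λ {x} {y} {z} → ⊑-trans {Th} {Es} {x} {y} {z}) e e-onto
         (λ σ → substFunc Th (Unifier.σ σ ↾Fin)) Ker⇒⊑

corollary3p8 : ExcludedMiddle 0ℓ → ExcludedMiddle (lsuc 0ℓ) →
    (S : Signature) (Th : Theory S) → LocallyFinite S Th →
    ((A : Algebra S) → _∈V_ S A Th → FinitelyPresented S Th A → Coexact S Th A →
       UnitaryOrFinitary (_≤C_ S {Th} {A}))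
    × ((Es : List (Term S ℕ × Term S ℕ)) → Unifier S Th Es →
       UnitaryOrFinitary (_⊑_ S {Th} {Es}))
corollary3p8 em₀ em₁ S Th lf =
  coexact-UnitaryOrFinitary em₀ em₁ Th lf , unifiers-UnitaryOrFinitary em₀ Th lf
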